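{- For every letter $n\ge 3$, the word $L(n)$ has prefix $n\,P_0(n)\,P_1(n)$, where $P_1(n)=\psi_1(P_0(n-1))$.
   Context: Words are over $\mathbb{N}=\{0,1,2,\dots\}$, letters written as numerals; positions indexed from $0$; $w[:-k]$ denotes $w$ with its last $k$ letters removed. A square is a nonempty word $yy$. For words $u,v$, $u\prec v$ means there is $i$ with $u[:i]=v[:i]$ and $u[i]<v[i]$. For a finite word $w$, $L(w)$ is the lexicographically least infinite word over $\mathbb{N}$ beginning with $w$ whose only square factors are contained in the prefix $w$. The ruler morphism is $\rho(n)=0\,(n+1)$, $R_n=\rho^n(0)$ is the prefix of length $2^n$ of the ruler sequence $\rho^\infty(0)=0102010301020104\cdots$. Let $P_0(n)=R_{n+1}[:-2]$ (equivalently, the longest prefix of the ruler sequence such that $nP_0(n)$ is a prefix of $L(n)$). The morphism $\psi_1$ is defined by $\psi_1(0)=202101$ and $\psi_1(n)=(n+1)\,P_0(n+1)$ for letters $n\ge1$. -}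

module Defs where

open import Data.Nat using (ℕ; zero; suc; _+_; _∸_; _<_; _≤_)
open import Data.List using (List; []; _∷_; _++_; length; take; concatMap)
open import Data.Product using (Σ; _×_; ∃)
open import Data.Unit using (⊤)
open import Relation.Binary.PropositionalEquality using (_≡_)
open import Relation.Nullary using (¬_)

Word∞ : Set
Word∞ = ℕ → ℕ

dropLast : ℕ → List ℕ → List ℕ
dropLast k w = take (length w ∸ k) w

IsPrefix : List ℕ → Word∞ → Set
IsPrefix []      x = ⊤
IsPrefix (a ∷ p) x = (a ≡ x 0) × IsPrefix p (λ i → x (suc i))

SquareAt : Word∞ → ℕ → ℕ → Set
SquareAt x i l = (0 < l) × (∀ k → k < l → x (i + k) ≡ x (i + l + k))

SquaresWithin : ℕ → Word∞ → Set
SquaresWithin m x = ∀ i l → SquareAt x i l → i + (l + l) ≤ m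

_≺_ : Word∞ → Word∞ → Set
y ≺ x = Σ ℕ λ i → (∀ j → j < i → y j ≡ x j) × (y i < x i)

Admissible : List ℕ → Word∞ → Set
Admissible w x = IsPrefix w x × SquaresWithin (length w) x

IsL : List ℕ → Word∞ → Set
IsL w x = Admissible w x × (∀ y → Admissible w y → ¬ (y ≺ x))

ρ : ℕ → List ℕ
ρ n = 0 ∷ suc n ∷ []

R : ℕ → List ℕ
R zero    = 0 ∷ []
R (suc n) = concatMap ρ (R n)

P₀ : ℕ → List ℕ
P₀ n = dropLast 2 (R (suc n))

ψ₁ : ℕ → List ℕ
ψ₁ zero    = 2 ∷ 0 ∷ 2 ∷ 1 ∷ 0 ∷ 1 ∷ []
ψ₁ (suc m) = suc (suc m) ∷ P₀ (suc (suc m))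

P₁ : ℕ → List ℕ
P₁ n = concatMap ψ₁ (P₀ (n ∸ 1))

-- L(n) is the greedy word: each letter is the least one that completes no square, and it is
-- the unique lexicographically least admissible word. So it suffices to show that the word
-- n P₀(n) P₁(n) is square-free and that each of its letters is greedy, i.e. every smaller
-- letter would complete a square.
--
-- Let N = n = m + 1, V = P₀(m) 0 and B(m) = P₀(m) P₁(m) ψ₁(0). Unfolding the definitions gives
-- n P₀(n) P₁(n) = N V N B N V N P₀(m) P₁(m) and B(m + 1) = V N B N V N B. Neither V nor B
-- contains N, so counting the letter N shows that the copies of N in a square line up with
-- consecutive separators of the word; this is impossible because V and B are incomparable for
-- the prefix order (after P₀(m) they continue with 0 and 2) and end in different letters.
-- For greediness, every letter of a ruler word is forced, N is forced after B because
-- P₀(m) P₁(m) ψ₁(0) c ends in a square for every c ≤ m, and P₁(m) ψ₁(0) is greedy after any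
-- word ending in P₀(m) after which the letter 2 is forced. The cases m = 2 are checked by
-- evaluating a decision procedure for squares.

module Submission where

open import Defs
open import Data.Nat using (ℕ; zero; suc; _+_; _∸_; _≤_; _<_; z≤n; s≤s; z<s; s<s; _≟_)
open import Data.Nat.Properties
open import Data.List.Extrema.Nat using (max; xs≤max)
open import Data.List using (List; []; _∷_; _++_; [_]; _∷ʳ_; length; take; drop; filter; concatMap; applyUpTo; initLast; _∷ʳ′_)
open import Data.List.Properties
open import Data.List.Relation.Unary.All as All using (All; []; _∷_)
import Data.List.Relation.Unary.All.Properties as All
open import Data.Product using (Σ-syntax; ∃; _×_; _,_; proj₁; proj₂)
open import Data.Sum using (_⊎_; inj₁; inj₂)
open import Data.Empty using (⊥; ⊥-elim)
open import Relation.Binary.Definitions using (tri<; tri≈; tri>)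
open import Data.Unit using (⊤; tt)
open import Function using (_∘_)
open import Relation.Binary.PropositionalEquality hiding ([_])
open import Relation.Nullary using (Dec; yes; no; ¬_; ¬?)
open import Relation.Nullary.Decidable using (_×-dec_; from-yes; decidable-stable)
open import Tactic.MonoidSolver using (solve)

Word : Set
Word = List ℕ

-- Squares in finite words

EndsInSquare : Word → Set
EndsInSquare w = Σ[ x ∈ Word ] Σ[ y ∈ Word ] y ≢ [] × w ≡ x ++ y ++ y

SquareFree : Word → Set
SquareFree w = ∀ x y z → x ++ y ++ y ++ z ≡ w → y ≡ []

endsInSquare-++ˡ : ∀ p {w} → EndsInSquare w → EndsInSquare (p ++ w)
endsInSquare-++ˡ p (x , y , y≢[] , refl) = p ++ x , y , y≢[] , sym (++-assoc p x (y ++ y))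

squareFree-++⁻ˡ : ∀ w {s} → SquareFree (w ++ s) → SquareFree w
squareFree-++⁻ˡ w {s} sf x y z eq = sf x y (z ++ s) (begin
  x ++ y ++ y ++ z ++ s   ≡⟨ solve (++-monoid ℕ) ⟩
  (x ++ y ++ y ++ z) ++ s ≡⟨ cong (_++ s) eq ⟩
  w ++ s                  ∎)
  where open ≡-Reasoning

squareFree-[] : SquareFree []
squareFree-[] x y z eq = ++-conicalˡ y _ (++-conicalʳ x _ eq)

squareFree-∷ : ∀ {a w} → SquareFree w → (∀ y z → y ++ y ++ z ≡ a ∷ w → y ≡ []) → SquareFree (a ∷ w)
squareFree-∷ sf noPrefixSquare []      y z eq = noPrefixSquare y z eq
squareFree-∷ sf noPrefixSquare (_ ∷ x) y z eq = sf x y z (∷-injectiveʳ eq)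

squareFree-∷ʳ : ∀ {u a} → SquareFree u → ¬ EndsInSquare (u ∷ʳ a) → SquareFree (u ∷ʳ a)
squareFree-∷ʳ sf ¬end x [] z eq = refl
squareFree-∷ʳ {u} sf ¬end x y@(_ ∷ _) z eq with initLast z
... | [] = ⊥-elim (¬end (x , y , (λ ()) , trans (sym eq) (cong (λ t → x ++ y ++ t) (++-identityʳ y))))
... | z′ ∷ʳ′ b = sf x y z′ (∷ʳ-injectiveˡ (x ++ y ++ y ++ z′) u (trans (reassoc x y z′ [ b ]) eq))
  where
  reassoc : ∀ (x y z w : Word) → (x ++ y ++ y ++ z) ++ w ≡ x ++ y ++ y ++ z ++ w
  reassoc x y z w = solve (++-monoid ℕ)

squareFree⇒¬endsInSquare : ∀ {w} → SquareFree w → ¬ EndsInSquare w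
squareFree⇒¬endsInSquare sf (x , y , y≢[] , eq) = y≢[] (sf x y [] (trans (cong (λ t → x ++ y ++ t) (++-identityʳ y)) (sym eq)))

endsInSquare⇒2≤length : ∀ {w} → EndsInSquare w → 2 ≤ length w
endsInSquare⇒2≤length (x , []    , y≢[] , _) = ⊥-elim (y≢[] refl)
endsInSquare⇒2≤length (x , b ∷ y , _    , refl) =
  ≤-trans (s≤s (≤-trans (s≤s z≤n) (≤-reflexive (sym (length-++-sucʳ y b y))))) (length-++-≤ʳ (b ∷ y ++ b ∷ y) {x})

IsSquare : Word → Set
IsSquare v = Σ[ y ∈ Word ] y ≢ [] × v ≡ y ++ y

take-length-++ : ∀ (y z : Word) → take (length y) (y ++ z) ≡ y
take-length-++ []      z = refl
take-length-++ (a ∷ y) z = cong (a ∷_) (take-length-++ y z)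

drop-length-++ : ∀ (y z : Word) → drop (length y) (y ++ z) ≡ z
drop-length-++ []      z = refl
drop-length-++ (a ∷ y) z = drop-length-++ y z

isSquare? : ∀ v → Dec (IsSquare v)
isSquare? v with anyUpTo? (λ l → ¬? (≡-dec _≟_ (take l v) []) ×-dec ≡-dec _≟_ (take l v) (drop l v)) (suc (length v))
... | yes (l , _ , y≢[] , halves) = yes (take l v , y≢[] , trans (sym (take++drop≡id l v)) (cong (take l v ++_) (sym halves)))
... | no ¬halves = no λ { (y , y≢[] , refl) → ¬halves (length y , s≤s (length-++-≤ˡ y) ,
        subst (_≢ []) (sym (take-length-++ y y)) y≢[] , trans (take-length-++ y y) (sym (drop-length-++ y y))) }

endsInSquare? : ∀ w → Dec (EndsInSquare w)
endsInSquare? [] = no λ { (_ , [] , y≢[] , _) → y≢[] refl ; ([] , _ ∷ _ , _ , ()) ; (_ ∷ _ , _ ∷ _ , _ , ()) }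
endsInSquare? (a ∷ w) with isSquare? (a ∷ w) | endsInSquare? w
... | yes (y , y≢[] , eq) | _     = yes ([] , y , y≢[] , eq)
... | no _ | yes (x , y , y≢[] , eq) = yes (a ∷ x , y , y≢[] , cong (a ∷_) eq)
... | no ¬square | no ¬end = no λ
  { ([]    , y , y≢[] , eq) → ¬square (y , y≢[] , eq)
  ; (_ ∷ x , y , y≢[] , eq) → ¬end (x , y , y≢[] , ∷-injectiveʳ eq) }

-- Greedy letters

Stepwise : (Word → ℕ → Set) → Word → Word → Set
Stepwise P u []      = ⊤
Stepwise P u (a ∷ v) = P u a × Stepwise P (u ∷ʳ a) v

stepwise? : ∀ {P} → (∀ u a → Dec (P u a)) → ∀ u v → Dec (Stepwise P u v)
stepwise? P? u []      = yes tt
stepwise? P? u (a ∷ v) = P? u a ×-dec stepwise? P? (u ∷ʳ a) v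

stepwise-++⁺ : ∀ {P} u v {w} → Stepwise P u v → Stepwise P (u ++ v) w → Stepwise P u (v ++ w)
stepwise-++⁺ {P} u []      sv sw = subst (λ t → Stepwise P t _) (++-identityʳ u) sw
stepwise-++⁺ {P} u (a ∷ v) (pa , sv) sw =
  pa , stepwise-++⁺ (u ∷ʳ a) v sv (subst (λ t → Stepwise P t _) (sym (++-assoc u [ a ] v)) sw)

stepwise-++⁻ˡ : ∀ {P} u v {w} → Stepwise P u (v ++ w) → Stepwise P u v
stepwise-++⁻ˡ u []      s        = tt
stepwise-++⁻ˡ u (a ∷ v) (pa , s) = pa , stepwise-++⁻ˡ (u ∷ʳ a) v s

stepwise-++ˡ : ∀ {P} → (∀ p u a → P u a → P (p ++ u) a) → ∀ p u v → Stepwise P u v → Stepwise P (p ++ u) v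
stepwise-++ˡ     P-++ˡ p u []      s        = tt
stepwise-++ˡ {P} P-++ˡ p u (a ∷ v) (pa , s) =
  P-++ˡ p u a pa , subst (λ t → Stepwise P t v) (sym (++-assoc p u [ a ])) (stepwise-++ˡ P-++ˡ p (u ∷ʳ a) v s)

SquareFreeStep : Word → ℕ → Set
SquareFreeStep u a = ¬ EndsInSquare (u ∷ʳ a)

squareFreeStep? : ∀ u a → Dec (SquareFreeStep u a)
squareFreeStep? u a = ¬? (endsInSquare? (u ∷ʳ a))

squareFree-stepwise : ∀ {u} v → SquareFree u → Stepwise SquareFreeStep u v → SquareFree (u ++ v)
squareFree-stepwise {u} []      sf _        = subst SquareFree (sym (++-identityʳ u)) sf
squareFree-stepwise {u} (a ∷ v) sf (¬end , s) =
  subst SquareFree (++-assoc u [ a ] v) (squareFree-stepwise v (squareFree-∷ʳ sf ¬end) s)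

squareFree⇒stepwise : ∀ u v → SquareFree (u ++ v) → Stepwise SquareFreeStep u v
squareFree⇒stepwise u []      sf = tt
squareFree⇒stepwise u (a ∷ v) sf =
  squareFree⇒¬endsInSquare (squareFree-++⁻ˡ (u ∷ʳ a) sf′) , squareFree⇒stepwise (u ∷ʳ a) v sf′
  where sf′ = subst SquareFree (sym (++-assoc u [ a ] v)) sf

stepwise-× : ∀ {P Q u} v → Stepwise P u v → Stepwise Q u v → Stepwise (λ u a → P u a × Q u a) u v
stepwise-× []      _          _          = tt
stepwise-× (a ∷ v) (pa , sp) (qa , sq) = (pa , qa) , stepwise-× v sp sq

Blocked : Word → ℕ → Set
Blocked u a = ∀ {c} → c < a → EndsInSquare (u ∷ʳ c)

blocked? : ∀ u a → Dec (Blocked u a)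
blocked? u a = allUpTo? (λ c → endsInSquare? (u ∷ʳ c)) a

blocked-++ˡ : ∀ p u a → Blocked u a → Blocked (p ++ u) a
blocked-++ˡ p u a blocked c<a = subst EndsInSquare (sym (++-assoc p u _)) (endsInSquare-++ˡ p (blocked c<a))

least-witness : ∀ {P : ℕ → Set} → (∀ c → Dec (P c)) → ∀ b → (∃ λ d → d < b × P d) →
                ∃ λ c → P c × (∀ {d} → d < c → ¬ P d)
least-witness P? (suc b) (d , d<1+b , Pd) with anyUpTo? P? b
... | yes below = least-witness P? b below
... | no ¬below = d , Pd , λ d′<d Pd′ → ¬below (_ , <-≤-trans d′<d (≤-pred d<1+b) , Pd′)

-- A letter larger than every letter of u cannot close a square: it would also occur in u.
squareFreeStep-fresh : ∀ u {c} → All (_< c) u → SquareFreeStep u c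
squareFreeStep-fresh u {c} u<c (x , y , y≢[] , eq) with initLast y
... | [] = y≢[] refl
... | y′ ∷ʳ′ d
  with ∷ʳ-injective u (x ++ y′ ∷ʳ d ++ y′)
         (trans eq (trans (cong (x ++_) (sym (++-assoc (y′ ∷ʳ d) y′ [ d ]))) (sym (++-assoc x _ [ d ]))))
... | refl , refl with All.++⁻ʳ y′ (All.++⁻ˡ (y′ ∷ʳ c) (All.++⁻ʳ x u<c))
... | c<c ∷ _ = <-irrefl refl c<c

GreedyLetter : Word → ℕ → Set
GreedyLetter u c = SquareFreeStep u c × Blocked u c

greedyLetter : ∀ u → ∃ (GreedyLetter u)
greedyLetter u with least-witness (squareFreeStep? u) (suc (suc (max 0 u)))
                           (suc (max 0 u) , ≤-refl , squareFreeStep-fresh u (All.map s≤s (xs≤max 0 u)))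
... | c , step , below = c , step , λ d<c → decidable-stable (endsInSquare? _) (below d<c)

greedyLetter-unique : ∀ {u a b} → GreedyLetter u a → GreedyLetter u b → a ≡ b
greedyLetter-unique {a = a} {b} (step-a , blocked-a) (step-b , blocked-b) with <-cmp a b
... | tri< a<b _ _ = ⊥-elim (step-a (blocked-b a<b))
... | tri≈ _ a≡b _ = a≡b
... | tri> _ _ b<a = ⊥-elim (step-b (blocked-a b<a))

-- Infinite words and the greedy word L(n)

applyUpTo-+ : ∀ (f : Word∞) m n → applyUpTo f (m + n) ≡ applyUpTo f m ++ applyUpTo (λ k → f (m + k)) n
applyUpTo-+ f zero    n = refl
applyUpTo-+ f (suc m) n = cong (f 0 ∷_) (applyUpTo-+ (f ∘ suc) m n)

applyUpTo-cong : ∀ (f g : Word∞) m → (∀ {k} → k < m → f k ≡ g k) → applyUpTo f m ≡ applyUpTo g m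
applyUpTo-cong f g zero    f≗g = refl
applyUpTo-cong f g (suc m) f≗g = cong₂ _∷_ (f≗g z<s) (applyUpTo-cong (f ∘ suc) (g ∘ suc) m (f≗g ∘ s<s))

applyUpTo-injective : ∀ (f g : Word∞) m → applyUpTo f m ≡ applyUpTo g m → ∀ {k} → k < m → f k ≡ g k
applyUpTo-injective f g (suc m) eq {zero}  _         = ∷-injectiveˡ eq
applyUpTo-injective f g (suc m) eq {suc k} (s<s k<m) = applyUpTo-injective (f ∘ suc) (g ∘ suc) m (∷-injectiveʳ eq) k<m

++-injective-length : ∀ (u u′ : Word) {v v′} → length u ≡ length u′ → u ++ v ≡ u′ ++ v′ → u ≡ u′ × v ≡ v′
++-injective-length []      []       _   eq = refl , eq
++-injective-length (a ∷ u) (a′ ∷ u′) len eq with ++-injective-length u u′ (suc-injective len) (∷-injectiveʳ eq)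
... | refl , v≡v′ = cong (_∷ u) (∷-injectiveˡ eq) , v≡v′

squareAt⇒endsInSquare : ∀ x i l → SquareAt x i l → EndsInSquare (applyUpTo x (i + (l + l)))
squareAt⇒endsInSquare x i l@(suc _) (_ , square) =
  applyUpTo x i , applyUpTo xᵢ l , (λ ()) , (begin
    applyUpTo x (i + (l + l))                                  ≡⟨ applyUpTo-+ x i (l + l) ⟩
    applyUpTo x i ++ applyUpTo xᵢ (l + l)                      ≡⟨ cong (applyUpTo x i ++_) (applyUpTo-+ xᵢ l l) ⟩
    applyUpTo x i ++ applyUpTo xᵢ l ++ applyUpTo (λ k → xᵢ (l + k)) l
      ≡⟨ cong (λ t → applyUpTo x i ++ applyUpTo xᵢ l ++ t) (applyUpTo-cong _ xᵢ l secondHalf) ⟩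
    applyUpTo x i ++ applyUpTo xᵢ l ++ applyUpTo xᵢ l          ∎)
  where
  open ≡-Reasoning
  xᵢ = λ k → x (i + k)
  secondHalf : ∀ {k} → k < l → x (i + (l + k)) ≡ x (i + k)
  secondHalf {k} k<l = trans (cong x (sym (+-assoc i l k))) (sym (square k k<l))

endsInSquare⇒squareAt : ∀ x m → EndsInSquare (applyUpTo x m) → ∃ λ i → ∃ λ l → SquareAt x i l × i + (l + l) ≡ m
endsInSquare⇒squareAt x m (X , Y , Y≢[] , eq) = length X , length Y , (length>0 Y Y≢[] , square) , sym m≡
  where
  i = length X
  l = length Y
  xᵢ = λ k → x (i + k)
  length>0 : ∀ (Y : Word) → Y ≢ [] → 0 < length Y
  length>0 []      Y≢[] = ⊥-elim (Y≢[] refl)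
  length>0 (_ ∷ _) _    = z<s
  m≡ : m ≡ i + (l + l)
  m≡ = trans (sym (length-applyUpTo x m)) (trans (cong length eq) (trans (length-++ X) (cong (i +_) (length-++ Y))))
  halves : applyUpTo xᵢ l ≡ Y × applyUpTo (λ k → xᵢ (l + k)) l ≡ Y
  halves with ++-injective-length (applyUpTo x i) X (length-applyUpTo x i) (begin
      applyUpTo x i ++ applyUpTo xᵢ (l + l) ≡⟨ applyUpTo-+ x i (l + l) ⟨
      applyUpTo x (i + (l + l))             ≡⟨ cong (applyUpTo x) m≡ ⟨
      applyUpTo x m                         ≡⟨ eq ⟩
      X ++ Y ++ Y                           ∎)
    where open ≡-Reasoning
  ... | _ , rest = ++-injective-length (applyUpTo xᵢ l) Y (length-applyUpTo xᵢ l) (trans (sym (applyUpTo-+ xᵢ l l)) rest)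
  square : ∀ k → k < l → x (i + k) ≡ x (i + l + k)
  square k k<l = trans (applyUpTo-injective xᵢ _ l (trans (proj₁ halves) (sym (proj₂ halves))) k<l)
                       (cong x (sym (+-assoc i l k)))

SquareFree∞ : Word∞ → Set
SquareFree∞ x = ∀ m → ¬ EndsInSquare (applyUpTo x m)

squareFree∞⇒squaresWithin : ∀ {x} k → SquareFree∞ x → SquaresWithin k x
squareFree∞⇒squaresWithin {x} k noEnd i l sq = ⊥-elim (noEnd _ (squareAt⇒endsInSquare x i l sq))

squaresWithin1⇒squareFree∞ : ∀ {x} → SquaresWithin 1 x → SquareFree∞ x
squaresWithin1⇒squareFree∞ {x} within m end with endsInSquare⇒squareAt x m end
... | i , suc l , sq , _ = <⇒≱ (<-≤-trans 1<2+2l (m≤n+m _ i)) (within i (suc l) sq)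
  where
  1<2+2l : 1 < suc l + suc l
  1<2+2l = s≤s (subst (1 ≤_) (sym (+-suc l l)) (s≤s z≤n))

isPrefix-applyUpTo : ∀ (x : Word∞) m → IsPrefix (applyUpTo x m) x
isPrefix-applyUpTo x zero    = tt
isPrefix-applyUpTo x (suc m) = refl , isPrefix-applyUpTo (x ∘ suc) m

isPrefix-cong : ∀ {x y : Word∞} p → (∀ k → x k ≡ y k) → IsPrefix p x → IsPrefix p y
isPrefix-cong []      x≗y _           = tt
isPrefix-cong (a ∷ p) x≗y (a≡ , rest) = trans a≡ (x≗y 0) , isPrefix-cong p (x≗y ∘ suc) rest

isL-unique : ∀ {w x y} → IsL w x → IsL w y → ∀ k → x k ≡ y k
isL-unique {x = x} {y} (adm-x , least-x) (adm-y , least-y) k = agreeBelow (suc k) ≤-refl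
  where
  agreeBelow : ∀ m {j} → j < m → x j ≡ y j
  agreeBelow (suc m) {j} (s≤s j≤m) with m≤n⇒m<n∨m≡n j≤m
  ... | inj₁ j<m = agreeBelow m j<m
  ... | inj₂ refl with <-cmp (x j) (y j)
  ...   | tri< x<y _ _ = ⊥-elim (least-y x adm-x (j , (λ i i<j → agreeBelow j i<j) , x<y))
  ...   | tri≈ _ x≡y _ = x≡y
  ...   | tri> _ _ y<x = ⊥-elim (least-x y adm-y (j , (λ i i<j → sym (agreeBelow j i<j)) , y<x))

module Greedy (n : ℕ) where

  prefix : ℕ → Word
  prefix zero    = [ n ]
  prefix (suc k) = prefix k ∷ʳ proj₁ (greedyLetter (prefix k))

  word : Word∞
  word zero    = n
  word (suc k) = proj₁ (greedyLetter (prefix k))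

  applyUpTo-word : ∀ k → applyUpTo word (suc k) ≡ prefix k
  applyUpTo-word zero    = refl
  applyUpTo-word (suc k) = trans (sym (applyUpTo-∷ʳ word (suc k))) (cong (_∷ʳ word (suc k)) (applyUpTo-word k))

  prefix-¬endsInSquare : ∀ k → ¬ EndsInSquare (prefix k)
  prefix-¬endsInSquare zero    end = <⇒≱ (s≤s (s≤s z≤n)) (endsInSquare⇒2≤length end)
  prefix-¬endsInSquare (suc k)     = proj₁ (proj₂ (greedyLetter (prefix k)))

  squareFree∞-word : SquareFree∞ word
  squareFree∞-word zero    end = <⇒≱ (s≤s z≤n) (endsInSquare⇒2≤length end)
  squareFree∞-word (suc k)     = subst (¬_ ∘ EndsInSquare) (sym (applyUpTo-word k)) (prefix-¬endsInSquare k)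

  admissible : Admissible [ n ] word
  admissible = (refl , tt) , squareFree∞⇒squaresWithin 1 squareFree∞-word

  minimal : ∀ y → Admissible [ n ] y → ¬ (y ≺ word)
  minimal y ((y0≡n , _) , within) (zero  , _     , y0<n) = <-irrefl (sym y0≡n) y0<n
  minimal y (_          , within) (suc k , agree , y<w)  =
    squaresWithin1⇒squareFree∞ {y} within (suc (suc k)) (subst EndsInSquare prefix≡ blocked)
    where
    blocked : EndsInSquare (prefix k ∷ʳ y (suc k))
    blocked = proj₂ (proj₂ (greedyLetter (prefix k))) y<w
    prefix≡ : prefix k ∷ʳ y (suc k) ≡ applyUpTo y (suc (suc k))
    prefix≡ = begin
      prefix k ∷ʳ y (suc k)                  ≡⟨ cong (_∷ʳ y (suc k)) (applyUpTo-word k) ⟨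
      applyUpTo word (suc k) ∷ʳ y (suc k)    ≡⟨ cong (_∷ʳ y (suc k)) (applyUpTo-cong word y (suc k) (sym ∘ agree _)) ⟩
      applyUpTo y (suc k) ∷ʳ y (suc k)       ≡⟨ applyUpTo-∷ʳ y (suc k) ⟩
      applyUpTo y (suc (suc k))              ∎
      where open ≡-Reasoning

  isL : IsL [ n ] word
  isL = admissible , minimal

  prefix-++ : ∀ k v → Stepwise GreedyLetter (prefix k) v → prefix (k + length v) ≡ prefix k ++ v
  prefix-++ k []      _ = trans (cong prefix (+-identityʳ k)) (sym (++-identityʳ (prefix k)))
  prefix-++ k (a ∷ v) (greedy-a , rest) = begin
    prefix (k + suc (length v))   ≡⟨ cong prefix (+-suc k (length v)) ⟩
    prefix (suc k + length v)     ≡⟨ prefix-++ (suc k) v (subst (λ t → Stepwise GreedyLetter t v) prefix-suc rest) ⟩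
    prefix (suc k) ++ v           ≡⟨ cong (_++ v) prefix-suc ⟨
    (prefix k ∷ʳ a) ++ v          ≡⟨ ++-assoc (prefix k) [ a ] v ⟩
    prefix k ++ a ∷ v             ∎
    where
    open ≡-Reasoning
    prefix-suc : prefix k ∷ʳ a ≡ prefix (suc k)
    prefix-suc = cong (prefix k ∷ʳ_) (greedyLetter-unique greedy-a (proj₂ (greedyLetter (prefix k))))

  isPrefix-greedy : ∀ t → Stepwise GreedyLetter [ n ] t → IsPrefix (n ∷ t) word
  isPrefix-greedy t greedy =
    subst (λ p → IsPrefix p word) (trans (applyUpTo-word (length t)) (prefix-++ 0 t greedy))
          (isPrefix-applyUpTo word (suc (length t)))

-- Square-freeness across a separator letter

_⊑_ : Word → Word → Set
u ⊑ v = ∃ λ k → u ++ k ≡ v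

⊑-diverge : ∀ q {a b u v} → a ≢ b → ¬ (q ++ a ∷ u) ⊑ (q ++ b ∷ v)
⊑-diverge q a≢b (k , eq) = a≢b (∷-injectiveˡ (++-cancelˡ q _ _ (trans (sym (++-assoc q _ k)) eq)))

⊑⇒length≤ : ∀ {u v} → u ⊑ v → length u ≤ length v
⊑⇒length≤ {u} (k , refl) = ≤-trans (m≤m+n _ (length k)) (≤-reflexive (sym (length-++ u)))

NoCommonSuffix : Word → Word → Set
NoCommonSuffix A B = ∀ x k s → s ≢ [] → x ++ s ≡ A → k ++ s ≡ B → ⊥

noCommonSuffix-∷ʳ : ∀ {A B a b} → a ≢ b → NoCommonSuffix (A ∷ʳ a) (B ∷ʳ b)
noCommonSuffix-∷ʳ a≢b x k s s≢[] xs≡A ks≡B with initLast s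
... | []       = s≢[] refl
... | s′ ∷ʳ′ c = a≢b (trans (sym (∷ʳ-injectiveʳ (x ++ s′) _ (trans (++-assoc x s′ [ c ]) xs≡A)))
                           (∷ʳ-injectiveʳ (k ++ s′) _ (trans (++-assoc k s′ [ c ]) ks≡B)))

noCommonSuffix-sym : ∀ {A B} → NoCommonSuffix A B → NoCommonSuffix B A
noCommonSuffix-sym ncs x k s s≢[] xs≡B ks≡A = ncs k x s s≢[] ks≡A xs≡B

++-split : ∀ (u v p q : Word) → u ++ v ≡ p ++ q →
  (∃ λ m → p ≡ u ++ m × v ≡ m ++ q) ⊎ (∃ λ m → u ≡ p ++ m × q ≡ m ++ v)
++-split []      v p       q eq = inj₁ (p , refl , eq)
++-split (a ∷ u) v []      q eq = inj₂ (a ∷ u , refl , sym eq)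
++-split (a ∷ u) v (b ∷ p) q eq with ∷-injective eq
... | refl , eq′ with ++-split u v p q eq′
...   | inj₁ (m , p≡ , v≡) = inj₁ (m , cong (a ∷_) p≡ , v≡)
...   | inj₂ (m , u≡ , q≡) = inj₂ (m , cong (a ∷_) u≡ , q≡)

Avoids : ℕ → Word → Set
Avoids N = All (_≢ N)

¬avoids : ∀ {N} u v → ¬ Avoids N (u ++ N ∷ v)
¬avoids u v avoids with All.++⁻ʳ u avoids
... | N≢N ∷ _ = N≢N refl

first-occurrence : ∀ N y → Avoids N y ⊎ (∃ λ y₁ → ∃ λ y₂ → Avoids N y₁ × y ≡ y₁ ++ N ∷ y₂)
first-occurrence N []      = inj₁ []
first-occurrence N (b ∷ y) with b ≟ N | first-occurrence N y
... | yes refl | _                          = inj₂ ([] , y , [] , refl)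
... | no b≢N   | inj₁ avoids                = inj₁ (b≢N ∷ avoids)
... | no b≢N   | inj₂ (y₁ , y₂ , avoids , refl) = inj₂ (b ∷ y₁ , y₂ , b≢N ∷ avoids , refl)

first-occurrence-unique : ∀ {N} p p′ {r r′} → Avoids N p → Avoids N p′ →
  p ++ N ∷ r ≡ p′ ++ N ∷ r′ → p ≡ p′ × r ≡ r′
first-occurrence-unique []      []       _          _          eq = refl , ∷-injectiveʳ eq
first-occurrence-unique []      (_ ∷ _)  _          (b≢N ∷ _)  eq = ⊥-elim (b≢N (sym (∷-injectiveˡ eq)))
first-occurrence-unique (_ ∷ _) []       (a≢N ∷ _)  _          eq = ⊥-elim (a≢N (∷-injectiveˡ eq))
first-occurrence-unique (a ∷ p) (_ ∷ p′) (_ ∷ avp) (_ ∷ avp′) eq with ∷-injective eq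
... | refl , eq′ with first-occurrence-unique p p′ avp avp′ eq′
...   | refl , r≡r′ = refl , r≡r′

avoiding-⊑ : ∀ {N} y {z A B} → Avoids N y → y ++ z ≡ A ++ N ∷ B → y ⊑ A
avoiding-⊑ y {z} {A} {B} avoids eq with ++-split y z A (_ ∷ B) eq
... | inj₁ (m , A≡ , _)        = m , sym A≡
... | inj₂ ([]    , y≡ , _)    = [] , trans (++-identityʳ y) (trans y≡ (++-identityʳ A))
... | inj₂ (c ∷ m , y≡ , N∷B≡) with ∷-injectiveˡ N∷B≡
...   | refl = ⊥-elim (¬avoids A m (subst (Avoids _) y≡ avoids))

locate : ∀ {N} x y₁ {R A W} → Avoids N A → Avoids N y₁ → x ++ y₁ ++ N ∷ R ≡ A ++ N ∷ W →
  (x ++ y₁ ≡ A × R ≡ W) ⊎ (∃ λ m → x ≡ A ++ N ∷ m × m ++ y₁ ++ N ∷ R ≡ W)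
locate {N} x y₁ {R} {A} {W} avA avy₁ eq with ++-split x (y₁ ++ N ∷ R) A (N ∷ W) eq
... | inj₁ (m , A≡ , rest) with first-occurrence-unique y₁ m avy₁ (All.++⁻ʳ x (subst (Avoids N) A≡ avA)) rest
...   | refl , R≡W = inj₁ (sym A≡ , R≡W)
locate {N} x []        avA avy₁ eq | inj₂ ([] , x≡ , rest) =
  inj₁ (trans (++-identityʳ x) (trans x≡ (++-identityʳ _)) , sym (∷-injectiveʳ rest))
locate {N} x (c ∷ y₁) avA (c≢N ∷ _) eq | inj₂ ([] , x≡ , rest) = ⊥-elim (c≢N (sym (∷-injectiveˡ rest)))
locate {N} x y₁ avA avy₁ eq | inj₂ (c ∷ m , x≡ , rest) with ∷-injective rest
... | refl , W≡ = inj₂ (m , x≡ , sym W≡)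

occurrences : ℕ → Word → ℕ
occurrences N w = length (filter (_≟ N) w)

occurrences-++ : ∀ N u v → occurrences N (u ++ v) ≡ occurrences N u + occurrences N v
occurrences-++ N u v = trans (cong length (filter-++ (_≟ N) u v)) (length-++ (filter (_≟ N) u))

occurrences-avoids : ∀ {N u} → Avoids N u → occurrences N u ≡ 0
occurrences-avoids {N} avoids = cong length (filter-none (_≟ N) avoids)

avoids-occurrences : ∀ {N} u → occurrences N u ≡ 0 → Avoids N u
avoids-occurrences {N} u none = All.¬Any⇒All¬ u (λ any → <⇒≢ (filter-some (_≟ N) any) (sym none))

occurrences-sep : ∀ {N} u v → Avoids N u → occurrences N (u ++ N ∷ v) ≡ suc (occurrences N v)
occurrences-sep {N} u v avoids = begin
  occurrences N (u ++ N ∷ v)               ≡⟨ occurrences-++ N u (N ∷ v) ⟩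
  occurrences N u + occurrences N (N ∷ v)  ≡⟨ cong₂ _+_ (occurrences-avoids avoids)
                                                        (cong length (filter-accept (_≟ N) refl)) ⟩
  suc (occurrences N v)                    ∎
  where open ≡-Reasoning

occurrences-square : ∀ N x y z → occurrences N y + occurrences N y ≤ occurrences N (x ++ y ++ y ++ z)
occurrences-square N x y z = begin
  occ y + occ y                       ≤⟨ +-monoʳ-≤ (occ y) (m≤m+n (occ y) (occ z)) ⟩
  occ y + (occ y + occ z)             ≤⟨ m≤n+m _ (occ x) ⟩
  occ x + (occ y + (occ y + occ z))   ≡⟨ cong (λ t → occ x + (occ y + t)) (occurrences-++ N y z) ⟨
  occ x + (occ y + occ (y ++ z))      ≡⟨ cong (occ x +_) (occurrences-++ N y (y ++ z)) ⟨
  occ x + occ (y ++ y ++ z)           ≡⟨ occurrences-++ N x (y ++ y ++ z) ⟨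
  occ (x ++ y ++ y ++ z)              ∎
  where
  open ≤-Reasoning
  occ = occurrences N

half-≤ : ∀ m k → m + m ≤ suc (k + k) → m ≤ k
half-≤ m k bound with m ≤? k
... | yes m≤k = m≤k
... | no m≰k = ⊥-elim (<⇒≱ (≤-trans (s≤s (≤-reflexive (sym (+-suc k k)))) (+-mono-≤ k<m k<m)) bound)
  where
  k<m : k < m
  k<m = ≰⇒> m≰k

SquareFreeAvoiding : ℕ → Word → Set
SquareFreeAvoiding N w = ∀ x y z → Avoids N y → x ++ y ++ y ++ z ≡ w → y ≡ []

squareFree⇒avoiding : ∀ {N w} → SquareFree w → SquareFreeAvoiding N w
squareFree⇒avoiding sf x y z _ = sf x y z

squareFreeAvoiding-sep : ∀ {N u v} → SquareFreeAvoiding N u → SquareFreeAvoiding N v → SquareFreeAvoiding N (u ++ N ∷ v)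
squareFreeAvoiding-sep {N} {u} {v} sf-u sf-v x y z avy eq with ++-split x (y ++ y ++ z) u (N ∷ v) eq
... | inj₂ ([] , _ , N∷v≡) with y | avy
...   | []    | _             = refl
...   | _ ∷ _ | (c≢N ∷ _)     = ⊥-elim (c≢N (sym (∷-injectiveˡ N∷v≡)))
squareFreeAvoiding-sep {N} {u} {v} sf-u sf-v x y z avy eq | inj₂ (c ∷ m , _ , N∷v≡) with ∷-injective N∷v≡
... | refl , v≡ = sf-v m y z avy (sym v≡)
squareFreeAvoiding-sep {N} {u} {v} sf-u sf-v x y z avy eq | inj₁ (m , u≡ , rest)
  with ++-split (y ++ y) z m (N ∷ v) (trans (++-assoc y y z) rest)
... | inj₁ (m′ , m≡ , _) = sf-u x y m′ avy (sym (trans u≡ (trans (cong (x ++_) m≡) (cong (x ++_) (++-assoc y y m′)))))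
... | inj₂ ([] , yy≡ , _) =
  sf-u x y [] avy (sym (trans u≡ (cong (x ++_) (trans (sym (++-identityʳ m)) (trans (sym yy≡) (cong (y ++_) (sym (++-identityʳ y))))))))
... | inj₂ (c ∷ j , yy≡ , N∷v≡) with ∷-injectiveˡ N∷v≡
...   | refl = ⊥-elim (¬avoids m j (subst (Avoids N) yy≡ (All.++⁺ avy avy)))

squareFree-intro : ∀ {N w} → SquareFreeAvoiding N w →
  (∀ x y₁ y₂ z → Avoids N y₁ → x ++ (y₁ ++ N ∷ y₂) ++ (y₁ ++ N ∷ y₂) ++ z ≡ w → ⊥) → SquareFree w
squareFree-intro {N} avoiding crossing x y z eq with first-occurrence N y
... | inj₁ avy                     = avoiding x y z avy eq
... | inj₂ (y₁ , y₂ , avy₁ , refl) = ⊥-elim (crossing x y₁ y₂ z avy₁ eq)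

squareFree-sep : ∀ {N u v} → Avoids N u → Avoids N v → SquareFree u → SquareFree v → SquareFree (u ++ N ∷ v)
squareFree-sep {N} {u} {v} avu avv sf-u sf-v =
  squareFree-intro (squareFreeAvoiding-sep (squareFree⇒avoiding sf-u) (squareFree⇒avoiding sf-v)) crossing
  where
  open ≤-Reasoning
  occ = occurrences N
  crossing : ∀ x y₁ y₂ z → Avoids N y₁ → x ++ (y₁ ++ N ∷ y₂) ++ (y₁ ++ N ∷ y₂) ++ z ≡ u ++ N ∷ v → ⊥
  crossing x y₁ y₂ z avy₁ eq = <⇒≱ (s≤s (s≤s z≤n)) (begin
    2                                       ≤⟨ +-mono-≤ (s≤s z≤n) (s≤s z≤n) ⟩
    suc (occ y₂) + suc (occ y₂)             ≡⟨ cong₂ _+_ occ-y occ-y ⟨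
    occ (y₁ ++ N ∷ y₂) + occ (y₁ ++ N ∷ y₂) ≤⟨ occurrences-square N x (y₁ ++ N ∷ y₂) z ⟩
    occ (x ++ _)                            ≡⟨ cong occ eq ⟩
    occ (u ++ N ∷ v)                        ≡⟨ occurrences-sep u v avu ⟩
    suc (occ v)                             ≡⟨ cong suc (occurrences-avoids avv) ⟩
    1                                       ∎)
    where occ-y = occurrences-sep y₁ y₂ avy₁

square-avoids : ∀ {N} x y z k y′ → occurrences N y ≡ k + occurrences N y′ →
  occurrences N (x ++ y ++ y ++ z) ≤ suc (k + k) → Avoids N y′
square-avoids {N} x y z k y′ occ-y bound = avoids-occurrences y′ (n≤0⇒n≡0 (+-cancelˡ-≤ k _ 0 (begin
  k + occurrences N y′ ≡⟨ occ-y ⟨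
  occurrences N y      ≤⟨ half-≤ _ k (≤-trans (occurrences-square N x y z) bound) ⟩
  k                    ≡⟨ +-identityʳ k ⟨
  k + 0                ∎)))
  where open ≤-Reasoning

squareFree-ANBNANB : ∀ {N A B} → Avoids N A → Avoids N B → SquareFree A → SquareFree B →
  ¬ A ⊑ B → ¬ B ⊑ A → NoCommonSuffix A B → SquareFree (A ++ N ∷ B ++ N ∷ A ++ N ∷ B)
squareFree-ANBNANB {N} {A} {B} avA avB sfA sfB ¬A⊑B ¬B⊑A ncs =
  squareFree-intro (squareFreeAvoiding-sep (squareFree⇒avoiding sfA) (squareFreeAvoiding-sep (squareFree⇒avoiding sfB)
                     (squareFreeAvoiding-sep (squareFree⇒avoiding sfA) (squareFree⇒avoiding sfB)))) crossing
  where
  shared-tail : ∀ {P Q} → NoCommonSuffix P Q → ¬ Q ⊑ P →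
                ∀ x y₁ {y₂} → x ++ y₁ ≡ P → y₂ ++ y₁ ≡ Q → y₂ ⊑ P → ⊥
  shared-tail ncs ¬Q⊑P x []          {y₂} _      y₂≡Q  y₂⊑P =
    ¬Q⊑P (subst (_⊑ _) (trans (sym (++-identityʳ y₂)) y₂≡Q) y₂⊑P)
  shared-tail ncs ¬Q⊑P x y₁@(_ ∷ _) {y₂} xy₁≡P y₂y₁≡Q _   = ncs x y₂ y₁ (λ ()) xy₁≡P y₂y₁≡Q

  occ-W : occurrences N (A ++ N ∷ B ++ N ∷ A ++ N ∷ B) ≡ 3
  occ-W = begin
    occurrences N (A ++ N ∷ B ++ N ∷ A ++ N ∷ B) ≡⟨ occurrences-sep A _ avA ⟩
    suc (occurrences N (B ++ N ∷ A ++ N ∷ B))    ≡⟨ cong suc (occurrences-sep B _ avB) ⟩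
    2 + occurrences N (A ++ N ∷ B)               ≡⟨ cong (2 +_) (occurrences-sep A B avA) ⟩
    3 + occurrences N B                          ≡⟨ cong (3 +_) (occurrences-avoids avB) ⟩
    3                                            ∎
    where open ≡-Reasoning

  reassoc : ∀ (x y₁ n y₂ z : Word) →
    x ++ (y₁ ++ n ++ y₂) ++ (y₁ ++ n ++ y₂) ++ z ≡ x ++ y₁ ++ n ++ (y₂ ++ y₁) ++ n ++ y₂ ++ z
  reassoc x y₁ n y₂ z = solve (++-monoid ℕ)

  -- y contains exactly one N; locate the first N of the square among the three of the word.
  crossing : ∀ x y₁ y₂ z → Avoids N y₁ →
    x ++ (y₁ ++ N ∷ y₂) ++ (y₁ ++ N ∷ y₂) ++ z ≡ A ++ N ∷ B ++ N ∷ A ++ N ∷ B → ⊥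
  crossing x y₁ y₂ z avy₁ eq
    with square-avoids x (y₁ ++ N ∷ y₂) z 1 y₂ (occurrences-sep y₁ y₂ avy₁)
           (≤-reflexive (trans (cong (occurrences N) eq) occ-W))
       | locate x y₁ avA avy₁ (trans (sym (reassoc x y₁ [ N ] y₂ z)) eq)
  ... | avy₂ | inj₁ (xy₁≡A , R≡) with first-occurrence-unique (y₂ ++ y₁) B (All.++⁺ avy₂ avy₁) avB R≡
  ...   | y₂y₁≡B , y₂z≡ = shared-tail ncs ¬B⊑A x y₁ xy₁≡A y₂y₁≡B (avoiding-⊑ y₂ avy₂ y₂z≡)
  crossing x y₁ y₂ z avy₁ eq | avy₂ | inj₂ (m , _ , rest) with locate m y₁ avB avy₁ rest
  ... | inj₁ (my₁≡B , R≡) with first-occurrence-unique (y₂ ++ y₁) A (All.++⁺ avy₂ avy₁) avA R≡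
  ...   | y₂y₁≡A , y₂z≡B = shared-tail (noCommonSuffix-sym ncs) ¬A⊑B m y₁ my₁≡B y₂y₁≡A (z , y₂z≡B)
  crossing x y₁ y₂ z avy₁ eq | avy₂ | inj₂ (m , _ , rest) | inj₂ (m′ , _ , rest′) with locate m′ y₁ avA avy₁ rest′
  ... | inj₁ (_ , R≡B)         = ¬avoids (y₂ ++ y₁) (y₂ ++ z) (subst (Avoids N) (sym R≡B) avB)
  ... | inj₂ (m″ , _ , rest″) = ¬avoids y₁ _ (All.++⁻ʳ m″ (subst (Avoids N) (sym rest″) avB))

squareFree-NANBNANB′ : ∀ {N A B B′} → Avoids N A → Avoids N B → Avoids N B′ →
  SquareFree (A ++ N ∷ B ++ N ∷ A ++ N ∷ B′) → ¬ A ⊑ B → ¬ B ⊑ B′ →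
  SquareFree (N ∷ A ++ N ∷ B ++ N ∷ A ++ N ∷ B′)
squareFree-NANBNANB′ {N} {A} {B} {B′} avA avB avB′ sf ¬A⊑B ¬B⊑B′ = squareFree-∷ sf prefixSquare
  where
  occ-W : occurrences N (N ∷ A ++ N ∷ B ++ N ∷ A ++ N ∷ B′) ≡ 4
  occ-W = begin
    occurrences N (N ∷ A ++ N ∷ B ++ N ∷ A ++ N ∷ B′) ≡⟨ occurrences-sep {N} [] _ [] ⟩
    1 + occurrences N (A ++ N ∷ B ++ N ∷ A ++ N ∷ B′) ≡⟨ cong suc (occurrences-sep A _ avA) ⟩
    2 + occurrences N (B ++ N ∷ A ++ N ∷ B′)          ≡⟨ cong (2 +_) (occurrences-sep B _ avB) ⟩
    3 + occurrences N (A ++ N ∷ B′)                   ≡⟨ cong (3 +_) (occurrences-sep A B′ avA) ⟩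
    4 + occurrences N B′                              ≡⟨ cong (4 +_) (occurrences-avoids avB′) ⟩
    4                                                 ∎
    where open ≡-Reasoning

  reassoc : ∀ (y₁ n y₂ z : Word) →
    (y₁ ++ n ++ y₂) ++ n ++ (y₁ ++ n ++ y₂) ++ z ≡ y₁ ++ n ++ y₂ ++ n ++ y₁ ++ n ++ y₂ ++ z
  reassoc y₁ n y₂ z = solve (++-monoid ℕ)

  prefixSquare : ∀ y z → y ++ y ++ z ≡ N ∷ A ++ N ∷ B ++ N ∷ A ++ N ∷ B′ → y ≡ []
  prefixSquare []       z _  = refl
  prefixSquare (c ∷ y′) z eq with ∷-injective eq
  ... | refl , eq′ with first-occurrence N y′
  ...   | inj₁ avy′ with first-occurrence-unique y′ A avy′ avA eq′
  ...     | refl , y′z≡ = ⊥-elim (¬A⊑B (avoiding-⊑ y′ avy′ y′z≡))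
  prefixSquare (c ∷ y′) z eq | refl , eq′ | inj₂ (y₁ , y₂ , avy₁ , refl)
    with square-avoids {N} [] (N ∷ y₁ ++ N ∷ y₂) z 2 y₂
           (trans (occurrences-sep {N} [] _ []) (cong suc (occurrences-sep y₁ y₂ avy₁)))
           (≤-trans (≤-reflexive (trans (cong (occurrences N) eq) occ-W)) (n≤1+n 4))
       | first-occurrence-unique y₁ A avy₁ avA (trans (sym (reassoc y₁ [ N ] y₂ z)) eq′)
  ... | avy₂ | refl , rest with first-occurrence-unique y₂ B avy₂ avB rest
  ...   | refl , rest′ with first-occurrence-unique y₁ A avy₁ avA rest′
  ...     | _ , y₂z≡B′ = ⊥-elim (¬B⊑B′ (z , y₂z≡B′))

-- The words P₀ and P₁

p₀ : ℕ → Word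
p₀ zero    = []
p₀ (suc k) = p₀ k ++ 0 ∷ suc k ∷ p₀ k

p₁ : ℕ → Word
p₁ zero          = []
p₁ (suc zero)    = []
p₁ (suc (suc k)) = p₁ (suc k) ++ ψ₁ 0 ++ suc (suc k) ∷ p₀ (suc (suc k)) ++ p₁ (suc k)

-- R_{n+1} without its last letter.
ruler : ℕ → Word
ruler n = p₀ n ∷ʳ 0

block : ℕ → Word
block n = p₀ n ++ p₁ n ++ ψ₁ 0

ρ-p₀ : ∀ n → concatMap ρ (p₀ n) ++ 0 ∷ [ 1 ] ≡ p₀ (suc n)
ρ-p₀ zero    = refl
ρ-p₀ (suc k) = begin
  concatMap ρ (p₀ k ++ 0 ∷ suc k ∷ p₀ k) ++ 0 ∷ [ 1 ]   ≡⟨ cong (_++ 0 ∷ [ 1 ]) (concatMap-++ ρ (p₀ k) _) ⟩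
  (c ++ 0 ∷ 1 ∷ 0 ∷ suc (suc k) ∷ c) ++ 0 ∷ [ 1 ]       ≡⟨ reassoc c (0 ∷ [ 1 ]) (0 ∷ [ suc (suc k) ]) ⟩
  (c ++ 0 ∷ [ 1 ]) ++ 0 ∷ suc (suc k) ∷ (c ++ 0 ∷ [ 1 ]) ≡⟨ cong₂ (λ a b → a ++ 0 ∷ suc (suc k) ∷ b) (ρ-p₀ k) (ρ-p₀ k) ⟩
  p₀ (suc (suc k))                                       ∎
  where
  open ≡-Reasoning
  c = concatMap ρ (p₀ k)
  reassoc : ∀ (c a b : Word) → (c ++ a ++ b ++ c) ++ a ≡ (c ++ a) ++ b ++ (c ++ a)
  reassoc c a b = solve (++-monoid ℕ)

R-suc : ∀ n → R (suc n) ≡ p₀ n ++ 0 ∷ [ suc n ]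
R-suc zero    = refl
R-suc (suc k) = begin
  concatMap ρ (R (suc k))                           ≡⟨ cong (concatMap ρ) (R-suc k) ⟩
  concatMap ρ (p₀ k ++ 0 ∷ [ suc k ])               ≡⟨ concatMap-++ ρ (p₀ k) (0 ∷ [ suc k ]) ⟩
  concatMap ρ (p₀ k) ++ 0 ∷ 1 ∷ 0 ∷ [ suc (suc k) ] ≡⟨ ++-assoc (concatMap ρ (p₀ k)) (0 ∷ [ 1 ]) _ ⟨
  (concatMap ρ (p₀ k) ++ 0 ∷ [ 1 ]) ++ 0 ∷ [ suc (suc k) ] ≡⟨ cong (_++ 0 ∷ [ suc (suc k) ]) (ρ-p₀ k) ⟩
  p₀ (suc k) ++ 0 ∷ [ suc (suc k) ]                 ∎
  where open ≡-Reasoning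

P₀≡p₀ : ∀ n → P₀ n ≡ p₀ n
P₀≡p₀ n = begin
  take (length (R (suc n)) ∸ 2) (R (suc n)) ≡⟨ cong (λ r → take (length r ∸ 2) r) (R-suc n) ⟩
  take (length r ∸ 2) r                      ≡⟨ cong (λ m → take m r) length∸2 ⟩
  take (length (p₀ n)) r                     ≡⟨ take-length-++ (p₀ n) _ ⟩
  p₀ n                                       ∎
  where
  open ≡-Reasoning
  r = p₀ n ++ 0 ∷ [ suc n ]
  length∸2 : length r ∸ 2 ≡ length (p₀ n)
  length∸2 = trans (cong (_∸ 2) (length-++ (p₀ n))) (m+n∸n≡m (length (p₀ n)) 2)

ψ₁-p₀ : ∀ m → concatMap ψ₁ (p₀ m) ≡ p₁ (suc m)
ψ₁-p₀ zero    = refl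
ψ₁-p₀ (suc j) = begin
  concatMap ψ₁ (p₀ j ++ 0 ∷ suc j ∷ p₀ j)                                        ≡⟨ concatMap-++ ψ₁ (p₀ j) _ ⟩
  concatMap ψ₁ (p₀ j) ++ ψ₁ 0 ++ (suc (suc j) ∷ P₀ (suc (suc j))) ++ concatMap ψ₁ (p₀ j)
    ≡⟨ cong₂ (λ s q → s ++ ψ₁ 0 ++ (suc (suc j) ∷ q) ++ s) (ψ₁-p₀ j) (P₀≡p₀ (suc (suc j))) ⟩
  p₁ (suc j) ++ ψ₁ 0 ++ (suc (suc j) ∷ p₀ (suc (suc j))) ++ p₁ (suc j)          ∎
  where open ≡-Reasoning

P₁≡p₁ : ∀ n → P₁ n ≡ p₁ n
P₁≡p₁ zero    = refl
P₁≡p₁ (suc m) = trans (cong (concatMap ψ₁) (P₀≡p₀ m)) (ψ₁-p₀ m)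

ruler-suc : ∀ k → ruler (suc k) ≡ ruler k ++ suc k ∷ ruler k
ruler-suc k = reassoc (p₀ k) [ 0 ] [ suc k ]
  where
  reassoc : ∀ (q a b : Word) → (q ++ a ++ b ++ q) ++ a ≡ (q ++ a) ++ b ++ (q ++ a)
  reassoc q a b = solve (++-monoid ℕ)

block-suc : ∀ k → let n = suc (suc k) in block (suc n) ≡ ruler n ++ suc n ∷ block n ++ suc n ∷ ruler n ++ suc n ∷ block n
block-suc k = reassoc (p₀ (suc (suc k))) (p₁ (suc (suc k))) (ψ₁ 0) [ 0 ] [ suc (suc (suc k)) ]
  where
  reassoc : ∀ (q s m a b : Word) →
    (q ++ a ++ b ++ q) ++ (s ++ m ++ b ++ (q ++ a ++ b ++ q) ++ s) ++ m ≡
    (q ++ a) ++ b ++ (q ++ s ++ m) ++ b ++ (q ++ a) ++ b ++ (q ++ s ++ m)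
  reassoc q s m a b = solve (++-monoid ℕ)

p₀p₁-suc : ∀ k → let n = suc (suc k) in
  suc n ∷ p₀ (suc n) ++ p₁ (suc n) ≡ suc n ∷ ruler n ++ suc n ∷ block n ++ suc n ∷ ruler n ++ suc n ∷ p₀ n ++ p₁ n
p₀p₁-suc k = cong (suc (suc (suc k)) ∷_) (reassoc (p₀ (suc (suc k))) (p₁ (suc (suc k))) (ψ₁ 0) [ 0 ] [ suc (suc (suc k)) ])
  where
  reassoc : ∀ (q s m a b : Word) →
    (q ++ a ++ b ++ q) ++ (s ++ m ++ b ++ (q ++ a ++ b ++ q) ++ s) ≡
    (q ++ a) ++ b ++ (q ++ s ++ m) ++ b ++ (q ++ a) ++ b ++ q ++ s
  reassoc q s m a b = solve (++-monoid ℕ)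

p₀-≤ : ∀ n → All (_≤ n) (p₀ n)
p₀-≤ zero    = []
p₀-≤ (suc k) = All.++⁺ (All.map m≤n⇒m≤1+n (p₀-≤ k)) (z≤n ∷ ≤-refl ∷ All.map m≤n⇒m≤1+n (p₀-≤ k))

ψ₁0-≤ : ∀ {n} → 2 ≤ n → All (_≤ n) (ψ₁ 0)
ψ₁0-≤ 2≤n = 2≤n ∷ z≤n ∷ 2≤n ∷ 1≤n ∷ z≤n ∷ 1≤n ∷ []
  where 1≤n = ≤-trans (s≤s z≤n) 2≤n

p₁-≤ : ∀ k → All (_≤ suc (suc k)) (p₁ (suc (suc k)))
p₁-≤ zero    = All.++⁺ (ψ₁0-≤ ≤-refl) (≤-refl ∷ All.++⁺ (p₀-≤ 2) [])
p₁-≤ (suc k) = All.++⁺ weakened (All.++⁺ (ψ₁0-≤ (s≤s (s≤s z≤n))) (≤-refl ∷ All.++⁺ (p₀-≤ _) weakened))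
  where weakened = All.map m≤n⇒m≤1+n (p₁-≤ k)

bounded-avoids : ∀ {n w} → All (_≤ n) w → Avoids (suc n) w
bounded-avoids = All.map λ a≤n a≡1+n → 1+n≰n (subst (_≤ _) a≡1+n a≤n)

ruler-avoids : ∀ n → Avoids (suc n) (ruler n)
ruler-avoids n = bounded-avoids (All.++⁺ (p₀-≤ n) (z≤n ∷ []))

p₀p₁-avoids : ∀ k → let n = suc (suc k) in Avoids (suc n) (p₀ n ++ p₁ n)
p₀p₁-avoids k = bounded-avoids (All.++⁺ (p₀-≤ _) (p₁-≤ k))

block-avoids : ∀ k → let n = suc (suc k) in Avoids (suc n) (block n)
block-avoids k = bounded-avoids (All.++⁺ (p₀-≤ _) (All.++⁺ (p₁-≤ k) (ψ₁0-≤ (s≤s (s≤s z≤n)))))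

ruler-squareFree : ∀ n → SquareFree (ruler n)
ruler-squareFree zero    = squareFree-sep [] [] squareFree-[] squareFree-[]
ruler-squareFree (suc k) = subst SquareFree (sym (ruler-suc k))
  (squareFree-sep (ruler-avoids k) (ruler-avoids k) (ruler-squareFree k) (ruler-squareFree k))

ruler-blocked : ∀ n → Blocked (ruler n) (suc n)
ruler-blocked zero    (s≤s z≤n) = [] , [ 0 ] , (λ ()) , refl
ruler-blocked (suc k) {c} (s≤s c≤1+k) with m≤n⇒m<n∨m≡n c≤1+k
... | inj₁ c≤k = subst EndsInSquare (sym (trans (cong (_∷ʳ c) (ruler-suc k)) (reassoc (ruler k) [ suc k ] [ c ])))
                   (endsInSquare-++ˡ (ruler k ∷ʳ suc k) (ruler-blocked k c≤k))
  where
  reassoc : ∀ (r b c : Word) → (r ++ b ++ r) ++ c ≡ (r ++ b) ++ (r ++ c)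
  reassoc r b c = solve (++-monoid ℕ)
... | inj₂ refl = [] , ruler k ∷ʳ suc k , (λ ()) ∘ ++-conicalʳ (ruler k) _ ,
                  trans (cong (_∷ʳ suc k) (ruler-suc k)) (reassoc (ruler k) [ suc k ])
  where
  reassoc : ∀ (r b : Word) → (r ++ b ++ r) ++ b ≡ (r ++ b) ++ (r ++ b)
  reassoc r b = solve (++-monoid ℕ)

ruler-greedy : ∀ p n → Stepwise Blocked p (ruler n)
ruler-greedy p zero    = (λ ()) , tt
ruler-greedy p (suc k) = subst (Stepwise Blocked p) (sym (ruler-suc k))
  (stepwise-++⁺ p (ruler k) (ruler-greedy p k)
    (blocked-++ˡ p (ruler k) (suc k) (ruler-blocked k) , ruler-greedy _ k))

p₀-greedy : ∀ p n → Stepwise Blocked p (p₀ n)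
p₀-greedy p n = stepwise-++⁻ˡ p (p₀ n) (ruler-greedy p n)

p₁ψ₁0-head : ∀ n T → ∃ λ U → p₁ n ++ ψ₁ 0 ++ T ≡ 2 ∷ U
p₁ψ₁0-head zero          T = _ , refl
p₁ψ₁0-head (suc zero)    T = _ , refl
p₁ψ₁0-head (suc (suc k)) T with p₁ψ₁0-head (suc k) ((suc (suc k) ∷ p₀ (suc (suc k)) ++ p₁ (suc k)) ++ ψ₁ 0 ++ T)
... | U , eq = U , trans (reassoc (p₁ (suc k)) (ψ₁ 0) (suc (suc k) ∷ p₀ (suc (suc k)) ++ p₁ (suc k)) T) eq
  where
  reassoc : ∀ (s m x t : Word) → (s ++ m ++ x) ++ m ++ t ≡ s ++ m ++ (x ++ m ++ t)
  reassoc s m x t = solve (++-monoid ℕ)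

block≡p₀-2 : ∀ n → ∃ λ U → block n ≡ p₀ n ++ 2 ∷ U
block≡p₀-2 n with p₁ψ₁0-head n []
... | U , eq = U , cong (p₀ n ++_) (trans (cong (p₁ n ++_) (sym (++-identityʳ (ψ₁ 0)))) eq)

¬ruler⊑block : ∀ n → ¬ ruler n ⊑ block n
¬ruler⊑block n with block≡p₀-2 n
... | U , eq = subst (λ t → ¬ ruler n ⊑ t) (sym eq) (⊑-diverge (p₀ n) (λ ()))

¬block⊑ruler : ∀ n → ¬ block n ⊑ ruler n
¬block⊑ruler n with block≡p₀-2 n
... | U , eq = subst (λ t → ¬ t ⊑ ruler n) (sym eq) (⊑-diverge (p₀ n) (λ ()))

¬block⊑p₀p₁ : ∀ n → ¬ block n ⊑ (p₀ n ++ p₁ n)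
¬block⊑p₀p₁ n ⊑ = <⇒≱ (m<m+n _ z<s) (≤-trans (≤-reflexive (sym length≡)) (⊑⇒length≤ ⊑))
  where
  length≡ : length (block n) ≡ length (p₀ n ++ p₁ n) + 6
  length≡ = trans (cong length (sym (++-assoc (p₀ n) (p₁ n) (ψ₁ 0)))) (length-++ (p₀ n ++ p₁ n))

ruler-block-noCommonSuffix : ∀ n → NoCommonSuffix (ruler n) (block n)
ruler-block-noCommonSuffix n = subst (NoCommonSuffix (ruler n)) (sym (reassoc (p₀ n) (p₁ n) (2 ∷ 0 ∷ 2 ∷ 1 ∷ [ 0 ]) [ 1 ]))
  (noCommonSuffix-∷ʳ {B = p₀ n ++ p₁ n ++ 2 ∷ 0 ∷ 2 ∷ 1 ∷ [ 0 ]} λ ())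
  where
  reassoc : ∀ (q s m b : Word) → q ++ s ++ m ++ b ≡ (q ++ s ++ m) ++ b
  reassoc q s m b = solve (++-monoid ℕ)

squareFree-block : ∀ k → SquareFree (block (suc (suc k)))
squareFree-block zero    = squareFree-stepwise (block 2) squareFree-[] (from-yes (stepwise? squareFreeStep? [] (block 2)))
squareFree-block (suc k) = subst SquareFree (sym (block-suc k))
  (squareFree-ANBNANB (ruler-avoids n) (block-avoids k) (ruler-squareFree n) (squareFree-block k)
    (¬ruler⊑block n) (¬block⊑ruler n) (ruler-block-noCommonSuffix n))
  where n = suc (suc k)

squareFree-p₀p₁ : ∀ k → let N = suc (suc (suc k)) in SquareFree (N ∷ p₀ N ++ p₁ N)
squareFree-p₀p₁ k = subst SquareFree (sym (p₀p₁-suc k))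
  (squareFree-NANBNANB′ (ruler-avoids n) (block-avoids k) (p₀p₁-avoids k) (squareFree-++⁻ˡ _ sf)
    (¬ruler⊑block n) (¬block⊑p₀p₁ n))
  where
  n = suc (suc k)
  N = suc n
  reassoc : ∀ (r b q ψ n : Word) → r ++ n ++ b ++ n ++ r ++ n ++ (q ++ ψ) ≡ (r ++ n ++ b ++ n ++ r ++ n ++ q) ++ ψ
  reassoc r b q ψ n = solve (++-monoid ℕ)
  sf : SquareFree ((ruler n ++ N ∷ block n ++ N ∷ ruler n ++ N ∷ p₀ n ++ p₁ n) ++ ψ₁ 0)
  sf = subst SquareFree (trans (block-suc k) (trans (cong (λ t → ruler n ++ N ∷ block n ++ N ∷ ruler n ++ N ∷ t)
                                                          (sym (++-assoc (p₀ n) (p₁ n) (ψ₁ 0))))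
                                              (reassoc (ruler n) (block n) (p₀ n ++ p₁ n) (ψ₁ 0) [ N ])))
             (squareFree-block (suc k))

-- Greediness of P₀ P₁

p₀p₁-step : ∀ m → ∃ λ p → p₀ (suc (suc m)) ++ p₁ (suc (suc m)) ≡ p ++ p₀ (suc m) ++ p₁ (suc m)
p₀p₁-step m = p₀ (suc (suc m)) ++ p₁ (suc m) ++ ψ₁ 0 ++ suc (suc m) ∷ p₀ (suc m) ++ 0 ∷ [ suc (suc m) ] ,
  reassoc (p₀ (suc m)) (p₁ (suc m)) (ψ₁ 0) [ suc (suc m) ] [ 0 ] (p₀ (suc (suc m)))
  where
  reassoc : ∀ (q s m b a q′ : Word) →
    q′ ++ s ++ m ++ b ++ (q ++ a ++ b ++ q) ++ s ≡ (q′ ++ s ++ m ++ b ++ q ++ a ++ b) ++ q ++ s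
  reassoc q s m b a q′ = solve (++-monoid ℕ)

p₀p₁-suffix : ∀ {c n} → 1 ≤ c → c ≤ n → ∃ λ p → p₀ n ++ p₁ n ≡ p ++ p₀ c ++ p₁ c
p₀p₁-suffix {c} {n} 1≤c c≤n with m≤n⇒m<n∨m≡n c≤n
... | inj₂ refl = [] , refl
p₀p₁-suffix {c} {suc zero} (s≤s z≤n) _ | inj₁ (s≤s ())
p₀p₁-suffix {c} {suc (suc m)} 1≤c _ | inj₁ (s≤s c≤1+m) with p₀p₁-step m | p₀p₁-suffix 1≤c c≤1+m
... | p , step | p′ , suffix = p ++ p′ , trans step (trans (cong (p ++_) suffix) (sym (++-assoc p p′ _)))

block-blocked : ∀ k → Blocked (block (suc (suc k))) (suc (suc (suc k)))
block-blocked k {c} (s≤s c≤n) = subst EndsInSquare (sym (reassoc (p₀ n) (p₁ n) (ψ₁ 0) [ c ])) (closes c c≤n)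
  where
  n = suc (suc k)
  reassoc : ∀ (q s m b : Word) → (q ++ s ++ m) ++ b ≡ (q ++ s) ++ m ++ b
  reassoc q s m b = solve (++-monoid ℕ)
  halves : ∀ (q s m b : Word) →
    (q ++ s ++ m ++ b ++ q ++ s) ++ m ++ b ≡ [] ++ (q ++ s ++ m ++ b) ++ (q ++ s ++ m ++ b)
  halves q s m b = solve (++-monoid ℕ)
  closes : ∀ c → c ≤ n → EndsInSquare ((p₀ n ++ p₁ n) ++ ψ₁ 0 ++ [ c ])
  closes zero       _ = endsInSquare-++ˡ (p₀ n ++ p₁ n) (2 ∷ 0 ∷ [ 2 ] , 1 ∷ [ 0 ] , (λ ()) , refl)
  closes (suc zero) _ = endsInSquare-++ˡ (p₀ n ++ p₁ n) (2 ∷ 0 ∷ 2 ∷ 1 ∷ [ 0 ] , [ 1 ] , (λ ()) , refl)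
  closes C@(suc (suc c)) C≤n with p₀p₁-suffix (s≤s z≤n) C≤n
  ... | p , suffix = subst (λ t → EndsInSquare (t ++ ψ₁ 0 ++ [ C ])) (sym suffix)
    (subst EndsInSquare (sym (++-assoc p (p₀ C ++ p₁ C) _))
      (endsInSquare-++ˡ p ([] , y , (λ ()) ∘ ++-conicalʳ (p₁ (suc c)) _ ∘ ++-conicalʳ (p₀ C) _ ,
                           halves (p₀ C) (p₁ (suc c)) (ψ₁ 0) [ C ])))
    where y = p₀ C ++ p₁ (suc c) ++ ψ₁ 0 ++ [ C ]

p₀-∷ʳ-1 : ∀ k → ∃ λ q → p₀ (suc k) ≡ q ∷ʳ 1
p₀-∷ʳ-1 zero    = [ 0 ] , refl
p₀-∷ʳ-1 (suc k) with p₀-∷ʳ-1 k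
... | q , eq = p₀ (suc k) ++ 0 ∷ suc (suc k) ∷ q ,
  trans (cong (λ t → p₀ (suc k) ++ 0 ∷ suc (suc k) ∷ t) eq) (sym (++-assoc (p₀ (suc k)) (0 ∷ suc (suc k) ∷ q) [ 1 ]))

repeat-blocked₂ : ∀ p a k → Blocked (p ++ a ∷ p₀ (suc k) ++ 0 ∷ a ∷ p₀ (suc k)) 2
repeat-blocked₂ p a k {zero} _ = p , a ∷ p₀ (suc k) ++ [ 0 ] , (λ ()) , reassoc p [ a ] (p₀ (suc k)) [ 0 ]
  where
  reassoc : ∀ (p a q z : Word) → (p ++ a ++ q ++ z ++ a ++ q) ++ z ≡ p ++ (a ++ q ++ z) ++ (a ++ q ++ z)
  reassoc p a q z = solve (++-monoid ℕ)
repeat-blocked₂ p a k {suc zero} _ with p₀-∷ʳ-1 k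
... | q , eq = subst (λ t → EndsInSquare ((p ++ a ∷ t ++ 0 ∷ a ∷ t) ++ [ 1 ])) (sym eq)
  (p ++ a ∷ (q ∷ʳ 1) ++ 0 ∷ a ∷ q , [ 1 ] , (λ ()) , reassoc p [ a ] q [ 0 ] [ 1 ])
  where
  reassoc : ∀ (p a q z o : Word) → (p ++ a ++ (q ++ o) ++ z ++ a ++ q ++ o) ++ o ≡ (p ++ a ++ (q ++ o) ++ z ++ a ++ q) ++ o ++ o
  reassoc p a q z o = solve (++-monoid ℕ)
repeat-blocked₂ p a k {suc (suc _)} (s≤s (s≤s ()))

p₁ψ₁0-greedy : ∀ k p → let n = suc (suc k) in Blocked (p ++ p₀ n) 2 → Stepwise Blocked (p ++ p₀ n) (p₁ n ++ ψ₁ 0)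
p₁ψ₁0-greedy zero p blocked₂ =
  blocked₂ , subst (λ t → Stepwise Blocked t rest) (sym (++-assoc p (p₀ 2) [ 2 ]))
                   (stepwise-++ˡ blocked-++ˡ p (p₀ 2 ∷ʳ 2) rest (from-yes (stepwise? blocked? (p₀ 2 ∷ʳ 2) rest)))
  where rest = drop 1 (p₁ 2 ++ ψ₁ 0)
-- p₁(N) ψ₁(0) = p₁(n) ψ₁(0) N p₀(N) p₁(n) ψ₁(0), and both copies of p₁(n) ψ₁(0) follow a
-- word ending in p₀(n) after which 2 is forced, so the induction hypothesis applies twice.
p₁ψ₁0-greedy (suc k) p blocked₂ =
  subst (Stepwise Blocked (p ++ p₀ N)) (sym unfold) (stepwise-++⁺ (p ++ p₀ N) (p₁ n ++ ψ₁ 0) first second)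
  where
  n = suc (suc k)
  N = suc n
  unfold : p₁ N ++ ψ₁ 0 ≡ (p₁ n ++ ψ₁ 0) ++ N ∷ p₀ N ++ p₁ n ++ ψ₁ 0
  unfold = reassoc (p₁ n) (ψ₁ 0) [ N ] (p₀ N)
    where
    reassoc : ∀ (s m b q : Word) → (s ++ m ++ b ++ q ++ s) ++ m ≡ (s ++ m) ++ b ++ q ++ s ++ m
    reassoc s m b q = solve (++-monoid ℕ)
  reassoc : ∀ (p q z b : Word) → (p ++ q ++ z ++ b) ++ q ≡ p ++ q ++ z ++ b ++ q
  reassoc p q z b = solve (++-monoid ℕ)
  p′ = p ++ p₀ n ++ 0 ∷ [ N ]
  first : Stepwise Blocked (p ++ p₀ N) (p₁ n ++ ψ₁ 0)
  first = subst (λ t → Stepwise Blocked t (p₁ n ++ ψ₁ 0)) (reassoc p (p₀ n) [ 0 ] [ N ])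
            (p₁ψ₁0-greedy k p′ (subst (λ t → Blocked t 2) (sym (reassoc p (p₀ n) [ 0 ] [ N ])) blocked₂))
  q = (p ++ p₀ N) ++ p₁ n ++ ψ₁ 0
  N-blocked : Blocked q N
  N-blocked = subst (λ t → Blocked t N) (reassoc′ p (p₀ n) [ 0 ] [ N ] (p₁ n) (ψ₁ 0))
                (blocked-++ˡ p′ (block n) N (block-blocked k))
    where
    reassoc′ : ∀ (p q z b s m : Word) → (p ++ q ++ z ++ b) ++ q ++ s ++ m ≡ (p ++ q ++ z ++ b ++ q) ++ s ++ m
    reassoc′ p q z b s m = solve (++-monoid ℕ)
  q′ = q ++ N ∷ p₀ n ++ 0 ∷ [ N ]
  second : Stepwise Blocked q (N ∷ p₀ N ++ p₁ n ++ ψ₁ 0)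
  second = N-blocked , stepwise-++⁺ (q ∷ʳ N) (p₀ N) (p₀-greedy _ N)
    (subst (λ t → Stepwise Blocked t (p₁ n ++ ψ₁ 0)) (reassoc″ q [ N ] (p₀ n) [ 0 ])
      (p₁ψ₁0-greedy k q′ (subst (λ t → Blocked t 2) (sym (reassoc‴ q [ N ] (p₀ n) [ 0 ])) (repeat-blocked₂ q N (suc k)))))
    where
    reassoc″ : ∀ (q b r z : Word) → (q ++ b ++ r ++ z ++ b) ++ r ≡ (q ++ b) ++ r ++ z ++ b ++ r
    reassoc″ q b r z = solve (++-monoid ℕ)
    reassoc‴ : ∀ (q b r z : Word) → (q ++ b ++ r ++ z ++ b) ++ r ≡ q ++ b ++ r ++ z ++ b ++ r
    reassoc‴ q b r z = solve (++-monoid ℕ)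

greedy-p₀p₁ : ∀ k → let N = suc (suc (suc k)) in Stepwise GreedyLetter [ N ] (p₀ N ++ p₁ N)
greedy-p₀p₁ k = stepwise-× (p₀ N ++ p₁ N) (squareFree⇒stepwise [ N ] (p₀ N ++ p₁ N) (squareFree-p₀p₁ k))
  (stepwise-++⁺ [ N ] (p₀ N) (p₀-greedy [ N ] N)
    (stepwise-++⁻ˡ (N ∷ p₀ N) (p₁ N) (p₁ψ₁0-greedy (suc k) [ N ] (repeat-blocked₂ [] N (suc k)))))
  where N = suc (suc (suc k))

theorem3p9 : ∀ (n : ℕ) → 3 ≤ n →
    (∃ λ x → IsL (n ∷ []) x) ×
    (∀ x → IsL (n ∷ []) x → IsPrefix (n ∷ (P₀ n ++ P₁ n)) x)
theorem3p9 N@(suc (suc (suc k))) (s≤s (s≤s (s≤s _))) = (word , isL) , λ x isL-x →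
  isPrefix-cong (N ∷ P₀ N ++ P₁ N) (isL-unique isL isL-x)
    (subst (λ t → IsPrefix (N ∷ t) word) (sym (cong₂ _++_ (P₀≡p₀ N) (P₁≡p₁ N)))
      (isPrefix-greedy (p₀ N ++ p₁ N) (greedy-p₀p₁ k)))
  where open Greedy N
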